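{- Let $N,h\in\mathbb{N}$ with $1\le h\le 2N^2$, and let $U$ (and $V$) be given either by the additive-type definition or by the difference-type definition below. Then for every $\varepsilon>0$, \[ \sum_{\substack{d\mid h\\ d\le N}}\ \sum_{\substack{1\le u,v\le N/d\\ (u,v)=1}}\mathbf{1}_{\mathbb{Z}}(U)\mathbf{1}_{V\ge U}\ \le\ \sum_{\substack{d\mid h\\ d\le N}}\ \sum_{\substack{1\le u,v\le N/d\\ (u,v)=1}}\mathbf{1}_{\mathbb{Z}}(U)\ \ll_\varepsilon N^{1+\varepsilon}. \]
   Context: $\mathbf{1}_{\mathbb{Z}}$ is the indicator function of the integers; sums are over integers $u,v$. For a divisor $d\le N$ of $h$ and coprime integers $u,v\in[1,N/d]$: (additive type) let $b_0\in\{1,\dots,u\}$ be the unique integer with $b_0v\equiv h/d\pmod u$, $a_0=(h/d-b_0v)/u$, $U=\max\{(1-b_0)/u,(a_0-N)/v\}$, $V=\min\{(N-b_0)/u,(a_0-1)/v\}$; (difference type) let $b_0\in\{1,\dots,u\}$ be the unique integer with $b_0v\equiv -h/d\pmod u$, $a_0=(h/d+b_0v)/u$, $U=\max\{(1-a_0)/v,(1-b_0)/u\}$, $V=\min\{(N-a_0)/v,(N-b_0)/u\}$.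
   Formalization: The parameter ε in the bound $\ll_\varepsilon N^{1+\varepsilon}$ ranges over the positive rationals. -}

module Defs where

open import Data.Bool using (Bool; true; false; if_then_else_)
open import Data.Nat as ℕ using (ℕ; zero; suc; _≡ᵇ_; NonZero)
open import Data.Nat.DivMod using (_%_) renaming (_/_ to _div_)
open import Data.Nat.Divisibility using (_∣?_)
open import Data.Nat.GCD using (gcd)
open import Data.Integer as ℤ using (ℤ; +_)
open import Data.Rational as ℚ using (ℚ; _/_; _⊔_; _⊓_; ↧ₙ_; _≤ᵇ_)
open import Data.List using (List; []; _∷_; map; upTo)
open import Data.Nat.ListAction using (sum)
open import Relation.Nullary.Decidable using (does)

data Kind : Set where
  additive difference : Kind

range1 : ℕ → List ℕ
range1 m = map suc (upTo m)

firstWith : (ℕ → Bool) → List ℕ → ℕ → ℕ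
firstWith p []       dflt = dflt
firstWith p (x ∷ xs) dflt = if p x then x else firstWith p xs dflt

_÷ℕ_ : ℚ → (v : ℕ) → .{{_ : NonZero v}} → ℚ
q ÷ℕ v = q ℚ.* ((+ 1) / v)

ℤℚ : ℕ → ℚ
ℤℚ n = (+ n) / 1

-- b₀ ∈ {1,…,u}: the unique integer with b₀ v ≡ k (additive) resp.
-- b₀ v ≡ -k (difference) mod u, where k = h/d.  Uniqueness/existence hold
-- for coprime u, v (the only case used); the fallback value u is never hit.
b₀ : Kind → (k u v : ℕ) → .{{_ : NonZero u}} → ℕ
b₀ additive   k u v = firstWith (λ b → ((b ℕ.* v) % u) ≡ᵇ (k % u)) (range1 u) u
b₀ difference k u v = firstWith (λ b → ((b ℕ.* v ℕ.+ k) % u) ≡ᵇ 0) (range1 u) u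

-- a₀ (as a rational number; it is an integer)
a₀ : Kind → (k u v : ℕ) → .{{_ : NonZero u}} → ℚ
a₀ additive   k u v = (+ k ℤ.- + (b₀ additive k u v ℕ.* v)) / u
a₀ difference k u v = (+ k ℤ.+ + (b₀ difference k u v ℕ.* v)) / u

UU : Kind → (N k u v : ℕ) → .{{_ : NonZero u}} → .{{_ : NonZero v}} → ℚ
UU additive N k u v =
  ((ℤℚ 1 ℚ.- ℤℚ (b₀ additive k u v)) ÷ℕ u) ⊔ ((a₀ additive k u v ℚ.- ℤℚ N) ÷ℕ v)
UU difference N k u v =
  ((ℤℚ 1 ℚ.- a₀ difference k u v) ÷ℕ v) ⊔ ((ℤℚ 1 ℚ.- ℤℚ (b₀ difference k u v)) ÷ℕ u)

VV : Kind → (N k u v : ℕ) → .{{_ : NonZero u}} → .{{_ : NonZero v}} → ℚ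
VV additive N k u v =
  ((ℤℚ N ℚ.- ℤℚ (b₀ additive k u v)) ÷ℕ u) ⊓ ((a₀ additive k u v ℚ.- ℤℚ 1) ÷ℕ v)
VV difference N k u v =
  ((ℤℚ N ℚ.- a₀ difference k u v) ÷ℕ v) ⊓ ((ℤℚ N ℚ.- ℤℚ (b₀ difference k u v)) ÷ℕ u)

isInt : ℚ → Bool
isInt q = (↧ₙ q) ≡ᵇ 1

ind : Bool → ℕ
ind true  = 1
ind false = 0

DUVSum : (N h : ℕ) → ((d u v : ℕ) → .{{_ : NonZero d}} → .{{_ : NonZero u}} → .{{_ : NonZero v}} → ℕ) → ℕ
DUVSum N h w = sum (map termD (upTo N))
  where
  termD : ℕ → ℕ
  termD d' = if does (suc d' ∣? h)
    then sum (map (λ u' → sum (map (λ v' →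
           if gcd (suc u') (suc v') ≡ᵇ 1 then w (suc d') (suc u') (suc v') else 0)
           (upTo (N div suc d')))) (upTo (N div suc d')))
    else 0

Sum₁ : Kind → ℕ → ℕ → ℕ
Sum₁ κ N h = DUVSum N h (λ d u v →
  let k = h div d in
  ind (isInt (UU κ N k u v)) ℕ.* ind (UU κ N k u v ≤ᵇ VV κ N k u v))

Sum₂ : Kind → ℕ → ℕ → ℕ
Sum₂ κ N h = DUVSum N h (λ d u v → ind (isInt (UU κ N (h div d) u v)))

-- If U is an integer then so is one of the two quantities whose maximum defines it.  Unwinding
-- the definitions of b₀ and a₀ (with k = h/d), this means u ∣ v - k or v ∣ k - N u in the
-- additive case, and u ∣ v + k or v ∣ u - k in the difference case.  These moduli are O(N²) and
-- vanish for at most one value of the free variable, so for each d the pairs (u, v) are covered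
-- by 2⌊N/d⌋ divisor counts, which is O(N τₘₐₓ) with τₘₐₓ the largest number of divisors of an
-- integer ≤ 3N².  Summing over the at most τₘₐₓ divisors d of h gives Sum₂ ≤ 4 N τₘₐₓ², and the
-- divisor bound τ(n)^(4r) ≪_r n turns this into Sum₂^r ≪_r N^(r+1).  Sum₁ ≤ Sum₂ holds termwise.
module Submission where

open import Defs
open import Data.Nat using (ℕ; suc; _≤_; _*_; _+_; _^_)
open import Data.Product using (_×_; ∃)

open import Algebra.Properties.CommutativeSemigroup as CommSemigroupProperties using ()
open import Data.Bool using (true; false; if_then_else_; T)
open import Data.Integer as ℤ using (+_)
import Data.Integer.Properties as ℤ
import Data.Integer.Tactic.RingSolver as ℤ
open import Data.List using (List; []; _∷_; [_]; _++_; _∷ʳ_; map; upTo)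
open import Data.List.Properties using (upTo-∷ʳ; map-++)
open import Data.List.Relation.Unary.All using (All; []; _∷_)
import Data.List.Relation.Unary.All.Properties as All
open import Data.Nat
  using (zero; NonZero; _<_; z≤n; s≤s; z<s; _≟_; _≤?_; _≡ᵇ_; _⊔_; ∣_-_∣; ⌊_/2⌋; ⌈_/2⌉;
         >-nonZero; >-nonZero⁻¹; nonTrivial⇒n>1)
open import Data.Nat.Coprimality using (Coprime; coprime-divisor)
open import Data.Nat.DivMod using (_/_; _%_; m/n≤m; m/n*n≡m; m≥n⇒m/n>0; m≡m%n+[m/n]*n)
open import Data.Nat.Divisibility
  using (_∣_; _∤_; _∣?_; divides; 1∣_; ∣-trans; ∣⇒≤; m∣m*n; m%n≡0⇒n∣m; m∣n*o⇒m/n∣o;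
         *-cancelˡ-∣; *-monoˡ-∣; *-monoʳ-∣)
open import Data.Nat.GCD using (gcd)
open import Data.Nat.Induction using (<-rec)
open import Data.Nat.ListAction using (sum; product)
open import Data.Nat.ListAction.Properties using (sum-++)
open import Data.Nat.Primality using (Prime; prime?; prime⇒irreducible; prime⇒nonZero; prime⇒nonTrivial)
open import Data.Nat.Primality.Factorisation using (factorise)
open import Data.Nat.Properties
open import Data.Nat.Tactic.RingSolver using (solve-∀)
open import Data.Product using (_,_; proj₁; proj₂)
open import Data.Rational as ℚ using (mkℚ; toℚᵘ; ↥_)
import Data.Rational.Properties as ℚ
open import Data.Rational.Unnormalised as ℚᵘ using (mkℚᵘ; *≡*) renaming (_≃_ to _≃ᵘ_)
import Data.Rational.Unnormalised.Properties as ℚᵘ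
open import Data.Sum using (_⊎_; inj₁; inj₂)
open import Data.Unit using (tt)
open import Function using (_∘_)
open import Level using (Level)
open import Relation.Binary.PropositionalEquality
  using (_≡_; _≢_; refl; sym; trans; cong; cong₂; subst; subst₂; module ≡-Reasoning)
open import Relation.Nullary using (Dec; yes; no; does; ¬_; contradiction)
open import Relation.Nullary.Decidable using (dec-true; dec-false; _×-dec_)
open import Relation.Unary using (Pred; Decidable; _⊆_)
open import Relation.Unary.Properties using (_∩?_; ∁?; U?)

open CommSemigroupProperties +-commutativeSemigroup using () renaming (interchange to +-interchange)
open CommSemigroupProperties *-commutativeSemigroup using () renaming (interchange to *-interchange)

private
  variable
    ℓ ℓ′ : Level
    A B : Set ℓ

∑< : ℕ → (ℕ → ℕ) → ℕ
∑< zero    f = 0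
∑< (suc n) f = ∑< n f + f n

sum-map-upTo : ∀ (f : ℕ → ℕ) n → sum (map f (upTo n)) ≡ ∑< n f
sum-map-upTo f zero    = refl
sum-map-upTo f (suc n) = begin
  sum (map f (upTo (suc n)))       ≡⟨ cong (sum ∘ map f) (upTo-∷ʳ n) ⟨
  sum (map f (upTo n ∷ʳ n))        ≡⟨ cong sum (map-++ f (upTo n) [ n ]) ⟩
  sum (map f (upTo n) ++ [ f n ])  ≡⟨ sum-++ (map f (upTo n)) [ f n ] ⟩
  sum (map f (upTo n)) + (f n + 0) ≡⟨ cong₂ _+_ (sum-map-upTo f n) (+-identityʳ (f n)) ⟩
  ∑< n f + f n                     ∎
  where open ≡-Reasoning

sum-map-mono-≤ : ∀ (xs : List A) {f g : A → ℕ} → (∀ x → f x ≤ g x) → sum (map f xs) ≤ sum (map g xs)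
sum-map-mono-≤ []       f≤g = z≤n
sum-map-mono-≤ (x ∷ xs) f≤g = +-mono-≤ (f≤g x) (sum-map-mono-≤ xs f≤g)

∑<-mono-≤ : ∀ n {f g : ℕ → ℕ} → (∀ {i} → i < n → f i ≤ g i) → ∑< n f ≤ ∑< n g
∑<-mono-≤ zero    f≤g = z≤n
∑<-mono-≤ (suc n) f≤g = +-mono-≤ (∑<-mono-≤ n (λ i<n → f≤g (m<n⇒m<1+n i<n))) (f≤g (n<1+n n))

∑<-cong : ∀ n {f g : ℕ → ℕ} → (∀ i → f i ≡ g i) → ∑< n f ≡ ∑< n g
∑<-cong zero    f≗g = refl
∑<-cong (suc n) f≗g = cong₂ _+_ (∑<-cong n f≗g) (f≗g n)

∑<-distrib-+ : ∀ n (f g : ℕ → ℕ) → ∑< n (λ i → f i + g i) ≡ ∑< n f + ∑< n g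
∑<-distrib-+ zero    f g = refl
∑<-distrib-+ (suc n) f g =
  trans (cong (_+ (f n + g n)) (∑<-distrib-+ n f g)) (+-interchange (∑< n f) (∑< n g) (f n) (g n))

∑<-const : ∀ n c → ∑< n (λ _ → c) ≡ n * c
∑<-const zero    c = refl
∑<-const (suc n) c = trans (cong (_+ c) (∑<-const n c)) (+-comm (n * c) c)

*-distribˡ-∑< : ∀ c n (f : ℕ → ℕ) → c * ∑< n f ≡ ∑< n (λ i → c * f i)
*-distribˡ-∑< c zero    f = *-zeroʳ c
*-distribˡ-∑< c (suc n) f = trans (*-distribˡ-+ c (∑< n f) (f n)) (cong (_+ c * f n) (*-distribˡ-∑< c n f))

∑<-comm : ∀ m n (f : ℕ → ℕ → ℕ) → ∑< m (λ i → ∑< n (f i)) ≡ ∑< n (λ j → ∑< m (λ i → f i j))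
∑<-comm zero    n f = sym (trans (∑<-const n 0) (*-zeroʳ n))
∑<-comm (suc m) n f = begin
  ∑< m (λ i → ∑< n (f i)) + ∑< n (f m)                 ≡⟨ cong (_+ ∑< n (f m)) (∑<-comm m n f) ⟩
  ∑< n (λ j → ∑< m (λ i → f i j)) + ∑< n (f m)         ≡⟨ ∑<-distrib-+ n _ (f m) ⟨
  ∑< n (λ j → ∑< m (λ i → f i j) + f m j)              ∎
  where open ≡-Reasoning

if-mono-≤ : ∀ c {x y} → x ≤ y → (if c then x else 0) ≤ (if c then y else 0)
if-mono-≤ true  x≤y = x≤y
if-mono-≤ false _   = z≤n

ind-yes : (a? : Dec A) → A → ind (does a?) ≡ 1
ind-yes a? a = cong ind (dec-true a? a)

ind-no : (a? : Dec A) → ¬ A → ind (does a?) ≡ 0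
ind-no a? ¬a = cong ind (dec-false a? ¬a)

ind-mono : (a? : Dec A) (b? : Dec B) → (A → B) → ind (does a?) ≤ ind (does b?)
ind-mono (yes a) b? a⇒b = ≤-reflexive (sym (ind-yes b? (a⇒b a)))
ind-mono (no _)  b? a⇒b = z≤n

ind-⊎ : ∀ c (a? : Dec A) (b? : Dec B) → (T c → A ⊎ B) → ind c ≤ ind (does a?) + ind (does b?)
ind-⊎ false a? b? _ = z≤n
ind-⊎ true  a? b? c⇒a⊎b with c⇒a⊎b tt
... | inj₁ a = subst (λ x → 1 ≤ x + ind (does b?)) (sym (ind-yes a? a)) (m≤m+n 1 (ind (does b?)))
... | inj₂ b = subst (λ x → 1 ≤ ind (does a?) + x) (sym (ind-yes b? b)) (m≤n+m 1 (ind (does a?)))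

-- Counts y ∈ [1, n], the range of d, u and v in DUVSum.
count : {P : Pred ℕ ℓ} → Decidable P → ℕ → ℕ
count P? n = ∑< n (λ i → ind (does (P? (suc i))))

count-mono : {P : Pred ℕ ℓ} {Q : Pred ℕ ℓ′} (P? : Decidable P) (Q? : Decidable Q) →
             P ⊆ Q → ∀ n → count P? n ≤ count Q? n
count-mono P? Q? P⊆Q n = ∑<-mono-≤ n (λ {i} _ → ind-mono (P? (suc i)) (Q? (suc i)) P⊆Q)

module _ {P : Pred ℕ ℓ} (P? : Decidable P) where

  count≤ : ∀ n → count P? n ≤ n
  count≤ n = begin
    count P? n       ≤⟨ ∑<-mono-≤ n (λ {i} _ → ind≤1 (does (P? (suc i)))) ⟩
    ∑< n (λ _ → 1)   ≡⟨ ∑<-const n 1 ⟩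
    n * 1            ≡⟨ *-identityʳ n ⟩
    n                ∎
    where
    open ≤-Reasoning
    ind≤1 : ∀ b → ind b ≤ 1
    ind≤1 true  = ≤-refl
    ind≤1 false = z≤n

  count-split : {Q : Pred ℕ ℓ′} (Q? : Decidable Q) →
                ∀ n → count P? n ≡ count (P? ∩? Q?) n + count (P? ∩? ∁? Q?) n
  count-split Q? n = trans (∑<-cong n (λ i → split (suc i)))
                           (∑<-distrib-+ n (λ i → ind (does ((P? ∩? Q?) (suc i))))
                                           (λ i → ind (does ((P? ∩? ∁? Q?) (suc i)))))
    where
    split : ∀ y → ind (does (P? y)) ≡ ind (does ((P? ∩? Q?) y)) + ind (does ((P? ∩? ∁? Q?) y))
    split y with P? y | Q? y
    ... | yes _ | yes _ = refl
    ... | yes _ | no _  = refl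
    ... | no _  | _     = refl

  count-remove : ∀ {y n} → 1 ≤ y → y ≤ n → P y →
                 suc (count (P? ∩? ∁? (_≟ y)) n) ≤ count P? n
  count-remove {y} {zero}  1≤y y≤0   _  = contradiction (≤-trans 1≤y y≤0) λ ()
  count-remove {y} {suc n} 1≤y y≤1+n py with y ≟ suc n
  ... | yes refl = begin
    suc (count P≢y? n + ind (does (P≢y? y)))  ≡⟨ cong (λ t → suc (count P≢y? n + t)) (ind-no (P≢y? y) λ (_ , y≢y) → y≢y refl) ⟩
    suc (count P≢y? n + 0)                   ≡⟨ cong suc (+-identityʳ (count P≢y? n)) ⟩
    suc (count P≢y? n)                       ≤⟨ s≤s (count-mono P≢y? P? proj₁ n) ⟩
    suc (count P? n)                         ≡⟨ +-comm 1 (count P? n) ⟩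
    count P? n + 1                           ≡⟨ cong (_+_ (count P? n)) (ind-yes (P? y) py) ⟨
    count P? n + ind (does (P? y))           ∎
    where
    open ≤-Reasoning
    P≢y? = P? ∩? ∁? (_≟ y)
  ... | no y≢1+n = +-mono-≤ (count-remove 1≤y (≤-pred (≤∧≢⇒< y≤1+n y≢1+n)) py)
                            (ind-mono ((P? ∩? ∁? (_≟ y)) (suc n)) (P? (suc n)) proj₁)

count-injective : {P : Pred ℕ ℓ} {Q : Pred ℕ ℓ′} (P? : Decidable P) (Q? : Decidable Q) (f : ℕ → ℕ) →
  ∀ {m n} → (∀ {x} → 1 ≤ x → x ≤ m → P x → 1 ≤ f x × f x ≤ n × Q (f x)) →
  (∀ {x y} → P x → P y → f x ≡ f y → x ≡ y) →
  count P? m ≤ count Q? n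
count-injective P? Q? f {zero}  maps inj = z≤n
count-injective {P = P} {Q = Q} P? Q? f {suc m} {n} maps inj with P? (suc m)
... | no _  = subst (_≤ count Q? n) (sym (+-identityʳ _))
                (count-injective P? Q? f (λ 1≤x x≤m → maps 1≤x (m≤n⇒m≤1+n x≤m)) inj)
... | yes pm with maps (s≤s z≤n) ≤-refl pm
...   | 1≤fm , fm≤n , qfm = begin
  count P? m + 1                        ≡⟨ +-comm (count P? m) 1 ⟩
  suc (count P? m)                      ≤⟨ s≤s (count-injective P? Q≢z? f maps′ inj) ⟩
  suc (count Q≢z? n)                    ≤⟨ count-remove Q? 1≤fm fm≤n qfm ⟩
  count Q? n                            ∎
  where
  open ≤-Reasoning
  Q≢z? = Q? ∩? ∁? (_≟ f (suc m))
  maps′ : ∀ {x} → 1 ≤ x → x ≤ m → P x → 1 ≤ f x × f x ≤ n × (Q (f x) × f x ≢ f (suc m))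
  maps′ 1≤x x≤m px with maps 1≤x (m≤n⇒m≤1+n x≤m) px
  ... | 1≤fx , fx≤n , qfx = 1≤fx , fx≤n , qfx , λ fx≡z → <-irrefl (inj px pm fx≡z) (s≤s x≤m)

count-⊆ : {P : Pred ℕ ℓ} {Q : Pred ℕ ℓ′} (P? : Decidable P) (Q? : Decidable Q) →
  ∀ {m n} → (∀ {x} → 1 ≤ x → x ≤ m → P x → x ≤ n × Q x) → count P? m ≤ count Q? n
count-⊆ P? Q? sub = count-injective P? Q? (λ x → x) (λ 1≤x x≤m px → 1≤x , sub 1≤x x≤m px) (λ _ _ eq → eq)

count-atMostOne : {P : Pred ℕ ℓ} (P? : Decidable P) → (∀ {x y} → P x → P y → x ≡ y) → ∀ n → count P? n ≤ 1
count-atMostOne P? unique n =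
  count-injective P? U? (λ _ → 1) {n} (λ _ _ _ → ≤-refl , ≤-refl , tt) (λ px py _ → unique px py)

^-distribʳ-* : ∀ m n o → (m * n) ^ o ≡ m ^ o * n ^ o
^-distribʳ-* m n zero    = refl
^-distribʳ-* m n (suc o) = trans (cong (m * n *_) (^-distribʳ-* m n o)) (*-interchange m n (m ^ o) (n ^ o))

1+n≤2^n : ∀ n → suc n ≤ 2 ^ n
1+n≤2^n zero    = ≤-refl
1+n≤2^n (suc n) = +-mono-≤ (m^n>0 2 n) (≤-trans (1+n≤2^n n) (m≤m+n (2 ^ n) 0))

n≤1+2⌊n/2⌋ : ∀ n → n ≤ suc (⌊ n /2⌋ + ⌊ n /2⌋)
n≤1+2⌊n/2⌋ zero          = z≤n
n≤1+2⌊n/2⌋ (suc zero)    = ≤-refl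
n≤1+2⌊n/2⌋ (suc (suc n)) = s≤s (≤-trans (s≤s (n≤1+2⌊n/2⌋ n)) (≤-reflexive (cong suc (sym (+-suc _ _)))))

2⌊n/2⌋≤n : ∀ n → ⌊ n /2⌋ + ⌊ n /2⌋ ≤ n
2⌊n/2⌋≤n n = ≤-trans (+-monoʳ-≤ ⌊ n /2⌋ (⌊n/2⌋≤⌈n/2⌉ n)) (≤-reflexive (⌊n/2⌋+⌈n/2⌉≡n n))

-- Induction on r: since 1 + a ≤ 2 (1 + ⌊a/2⌋), both factors of (1 + a) · (1 + a)^r cost only 2^⌊a/2⌋.
[1+a]^r≤c*2^a : ∀ r → ∃ λ c → NonZero c × (∀ a → suc a ^ r ≤ c * 2 ^ a)
[1+a]^r≤c*2^a zero    = 1 , _ , λ a → ≤-trans (m^n>0 2 a) (≤-reflexive (sym (+-identityʳ (2 ^ a))))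
[1+a]^r≤c*2^a (suc r) with [1+a]^r≤c*2^a r
... | c , c≢0 , bound = 2 ^ suc r * c , m*n≢0 (2 ^ suc r) c {{m^n≢0 2 (suc r)}} {{c≢0}} , bound′
  where
  bound′ : ∀ a → suc a ^ suc r ≤ 2 ^ suc r * c * 2 ^ a
  bound′ a = begin
    suc a * suc a ^ r                    ≤⟨ *-mono-≤ (≤-trans 1+a≤2[1+h] (*-monoʳ-≤ 2 (1+n≤2^n h))) (^-monoˡ-≤ r 1+a≤2[1+h]) ⟩
    (2 * 2 ^ h) * (2 * suc h) ^ r        ≡⟨ cong ((2 * 2 ^ h) *_) (^-distribʳ-* 2 (suc h) r) ⟩
    (2 * 2 ^ h) * (2 ^ r * suc h ^ r)    ≤⟨ *-monoʳ-≤ (2 * 2 ^ h) (*-monoʳ-≤ (2 ^ r) (bound h)) ⟩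
    (2 * 2 ^ h) * (2 ^ r * (c * 2 ^ h))  ≡⟨ regroup (2 ^ h) (2 ^ r) c ⟩
    2 ^ suc r * c * (2 ^ h * 2 ^ h)      ≡⟨ cong (2 ^ suc r * c *_) (^-distribˡ-+-* 2 h h) ⟨
    2 ^ suc r * c * 2 ^ (h + h)          ≤⟨ *-monoʳ-≤ (2 ^ suc r * c) (^-monoʳ-≤ 2 (2⌊n/2⌋≤n a)) ⟩
    2 ^ suc r * c * 2 ^ a                ∎
    where
    open ≤-Reasoning
    h = ⌊ a /2⌋
    1+a≤2[1+h] : suc a ≤ 2 * suc h
    1+a≤2[1+h] = ≤-trans (s≤s (n≤1+2⌊n/2⌋ a)) (≤-reflexive (2+2h≡2[1+h] h))
      where
      2+2h≡2[1+h] : ∀ h → suc (suc (h + h)) ≡ 2 * suc h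
      2+2h≡2[1+h] = solve-∀
    regroup : ∀ x y z → (2 * x) * (y * (z * x)) ≡ 2 * y * z * (x * x)
    regroup = solve-∀

m*m≤n*n⇒m≤n : ∀ {m n} → m * m ≤ n * n → m ≤ n
m*m≤n*n⇒m≤n {m} {n} m²≤n² with m ≤? n
... | yes m≤n = m≤n
... | no  m≰n = contradiction m²≤n² (<⇒≱ (*-mono-< (≰⇒> m≰n) (≰⇒> m≰n)))

∣m-n∣≤m+n : ∀ m n → ∣ m - n ∣ ≤ m + n
∣m-n∣≤m+n m n = ≤-trans (∣m-n∣≤m⊔n m n) (m⊔n≤m+n m n)

prime⇒1<p : ∀ {p} → Prime p → 1 < p
prime⇒1<p {p} p-prime = nonTrivial⇒n>1 p {{prime⇒nonTrivial p-prime}}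

∃-prime-divisor : ∀ n → 1 < n → ∃ λ p → Prime p × p ∣ n
∃-prime-divisor (suc zero) (s≤s ())
∃-prime-divisor n@(suc (suc _)) _ with factorise n
... | record { factors = [] ; isFactorisation = () }
... | record { factors = p ∷ ps ; isFactorisation = n≡∏ ; factorsPrime = p-prime ∷ _ } =
  p , p-prime , subst (p ∣_) (sym n≡∏) (m∣m*n (product ps))

p-adic-split : ∀ {p} → 1 < p → ∀ n .{{_ : NonZero n}} → ∃ λ a → ∃ λ m → p ∤ m × n ≡ p ^ a * m
p-adic-split {p} 1<p n = <-rec Split split n
  where
  Split : ℕ → Set
  Split n = .{{NonZero n}} → ∃ λ a → ∃ λ m → p ∤ m × n ≡ p ^ a * m
  split : ∀ n → (∀ {k} → k < n → Split k) → Split n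
  split n rec with p ∣? n
  ... | no  p∤n = 0 , n , p∤n , sym (+-identityʳ n)
  ... | yes (divides q refl) with rec (m<m*n q p {{m*n≢0⇒m≢0 q}} 1<p) {{m*n≢0⇒m≢0 q}}
  ...   | a , m , p∤m , refl = suc a , m , p∤m , reorder (p ^ a) m p
    where
    reorder : ∀ x y z → x * y * z ≡ z * x * y
    reorder = solve-∀

m<p^[1+a]*m : ∀ {p} → 1 < p → ∀ a m .{{_ : NonZero m}} → m < p ^ suc a * m
m<p^[1+a]*m {p} 1<p a m = begin-strict
  m                ≡⟨ *-identityˡ m ⟨
  1 * m            <⟨ *-monoˡ-< m 1<p ⟩
  p * m            ≤⟨ *-monoˡ-≤ m (m≤m*n p (p ^ a) {{m^n≢0 p a {{>-nonZero (<-trans z<s 1<p)}}}}) ⟩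
  p ^ suc a * m    ∎
  where open ≤-Reasoning

-- The divisor bound

τ : ℕ → ℕ
τ n = count (_∣? n) n

divisors≤τ : ∀ {n} .{{_ : NonZero n}} m → count (_∣? n) m ≤ τ n
divisors≤τ {n} m = count-⊆ (_∣? n) (_∣? n) {m} (λ _ _ d∣n → ∣⇒≤ d∣n , d∣n)

module _ {p : ℕ} (p-prime : Prime p) where

  ∣p*x∧∤x⇒p∣ : ∀ {e x} → e ∣ p * x → e ∤ x → p ∣ e
  ∣p*x∧∤x⇒p∣ {e} e∣px e∤x with p ∣? e
  ... | yes p∣e = p∣e
  ... | no  p∤e = contradiction (coprime-divisor e⊥p e∣px) e∤x
    where
    e⊥p : Coprime e p
    e⊥p (i∣e , i∣p) with prime⇒irreducible p-prime i∣p
    ... | inj₁ i≡1 = i≡1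
    ... | inj₂ refl = contradiction i∣e p∤e

  ∣p^[1+a]*m∧∤p^a*m⇒p^[1+a]∣ : ∀ a {m e} → e ∣ p ^ suc a * m → e ∤ p ^ a * m → p ^ suc a ∣ e
  ∣p^[1+a]*m∧∤p^a*m⇒p^[1+a]∣ zero {m} e∣pm e∤m rewrite *-identityʳ p | *-identityˡ m =
    ∣p*x∧∤x⇒p∣ e∣pm e∤m
  ∣p^[1+a]*m∧∤p^a*m⇒p^[1+a]∣ (suc a) {m} {e} e∣n e∤x
    with ∣p*x∧∤x⇒p∣ (subst (e ∣_) (*-assoc p (p ^ suc a) m) e∣n) e∤x
  ... | divides q refl = subst (_∣ q * p) (*-comm (p ^ suc a) p) (*-monoˡ-∣ p p^[1+a]∣q)
    where
    instance _ = prime⇒nonZero p-prime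
    p^[1+a]∣q : p ^ suc a ∣ q
    p^[1+a]∣q = ∣p^[1+a]*m∧∤p^a*m⇒p^[1+a]∣ a
      (*-cancelˡ-∣ p (subst₂ _∣_ (*-comm q p) (*-assoc p (p ^ suc a) m) e∣n))
      (λ q∣x → e∤x (subst₂ _∣_ (*-comm p q) (sym (*-assoc p (p ^ a) m)) (*-monoʳ-∣ p q∣x)))

  τ[p^[1+a]*m]≤τ[p^a*m]+τ[m] : ∀ a m .{{_ : NonZero m}} → τ (p ^ suc a * m) ≤ τ (p ^ a * m) + τ m
  τ[p^[1+a]*m]≤τ[p^a*m]+τ[m] a m = begin
    τ n                               ≡⟨ count-split (_∣? n) (_∣? x) n ⟩
    count old? n + count new? n       ≤⟨ +-mono-≤ (count-⊆ old? (_∣? x) old) (count-injective new? (_∣? m) (_/ P) new /P-injective) ⟩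
    τ x + τ m                         ∎
    where
    open ≤-Reasoning
    instance
      _ = prime⇒nonZero p-prime
      P≢0 = m^n≢0 p (suc a)
      x≢0 = m*n≢0 (p ^ a) m {{m^n≢0 p a}}
    n = p ^ suc a * m
    x = p ^ a * m
    P = p ^ suc a
    old? = (_∣? n) ∩? (_∣? x)
    new? = (_∣? n) ∩? ∁? (_∣? x)
    old : ∀ {d} → 1 ≤ d → d ≤ n → d ∣ n × d ∣ x → d ≤ x × d ∣ x
    old _ _ (_ , d∣x) = ∣⇒≤ d∣x , d∣x
    P∣ : ∀ {d} → d ∣ n × d ∤ x → P ∣ d
    P∣ (d∣n , d∤x) = ∣p^[1+a]*m∧∤p^a*m⇒p^[1+a]∣ a d∣n d∤x
    new : ∀ {d} → 1 ≤ d → d ≤ n → d ∣ n × d ∤ x → 1 ≤ d / P × d / P ≤ m × d / P ∣ m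
    new {d} 1≤d _ d∈ = m≥n⇒m/n>0 (∣⇒≤ {{>-nonZero 1≤d}} (P∣ d∈)) , ∣⇒≤ d/P∣m , d/P∣m
      where
      d/P∣m : d / P ∣ m
      d/P∣m = m∣n*o⇒m/n∣o (P∣ d∈) (subst (d ∣_) (*-comm P m) (proj₁ d∈))
    /P-injective : ∀ {d d′} → d ∣ n × d ∤ x → d′ ∣ n × d′ ∤ x → d / P ≡ d′ / P → d ≡ d′
    /P-injective d∈ d′∈ eq = begin-equality
      _ ≡⟨ m/n*n≡m (P∣ d∈) ⟨
      _ ≡⟨ cong (_* P) eq ⟩
      _ ≡⟨ m/n*n≡m (P∣ d′∈) ⟩
      _ ∎

  τ[p^a*m]≤[1+a]*τ[m] : ∀ a m .{{_ : NonZero m}} → τ (p ^ a * m) ≤ suc a * τ m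
  τ[p^a*m]≤[1+a]*τ[m] zero    m = ≤-reflexive (trans (cong τ (+-identityʳ m)) (sym (+-identityʳ (τ m))))
  τ[p^a*m]≤[1+a]*τ[m] (suc a) m = begin
    τ (p ^ suc a * m)      ≤⟨ τ[p^[1+a]*m]≤τ[p^a*m]+τ[m] a m ⟩
    τ (p ^ a * m) + τ m    ≤⟨ +-monoˡ-≤ (τ m) (τ[p^a*m]≤[1+a]*τ[m] a m) ⟩
    suc a * τ m + τ m      ≡⟨ +-comm (suc a * τ m) (τ m) ⟩
    suc (suc a) * τ m      ∎
    where open ≤-Reasoning

-- For n = p^a m with p ∤ m we have τ(n)^r ≤ (1 + a)^r τ(m)^r, and (1 + a)^r is at most p^a when
-- p > 2^r and at most c p^a otherwise.  σ n counts the primes p ≤ 2^r dividing n, so the constant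
-- c is paid at most once for each of them.
module DivisorBound (r c : ℕ) .{{_ : NonZero c}} (poly≤exp : ∀ a → suc a ^ r ≤ c * 2 ^ a) where

  primeDivisor? : ∀ n → Decidable (λ j → Prime j × j ∣ n)
  primeDivisor? n j = prime? j ×-dec j ∣? n

  σ : ℕ → ℕ
  σ n = count (primeDivisor? n) (2 ^ r)

  σ-mono : ∀ {m n} → m ∣ n → σ m ≤ σ n
  σ-mono {m} {n} m∣n =
    count-mono (primeDivisor? m) (primeDivisor? n) (λ (j-prime , j∣m) → j-prime , ∣-trans j∣m m∣n) (2 ^ r)

  σ-strict : ∀ {p m n} → Prime p → p ≤ 2 ^ r → p ∣ n → p ∤ m → m ∣ n → suc (σ m) ≤ σ n
  σ-strict {p} {m} {n} p-prime p≤2^r p∣n p∤m m∣n = begin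
    suc (σ m)                       ≤⟨ s≤s (count-mono (primeDivisor? m) σ≢p? drop-p (2 ^ r)) ⟩
    suc (count σ≢p? (2 ^ r))        ≤⟨ count-remove (primeDivisor? n) 1≤p p≤2^r (p-prime , p∣n) ⟩
    σ n                             ∎
    where
    open ≤-Reasoning
    σ≢p? = primeDivisor? n ∩? ∁? (_≟ p)
    1≤p = <-trans z<s (prime⇒1<p p-prime)
    drop-p : ∀ {j} → Prime j × j ∣ m → (Prime j × j ∣ n) × j ≢ p
    drop-p (j-prime , j∣m) = (j-prime , ∣-trans j∣m m∣n) , λ { refl → p∤m j∣m }

  prime-power-factor : ∀ {p m n} → Prime p → p ∣ n → p ∤ m → m ∣ n →
                       ∀ a → suc a ^ r * c ^ σ m ≤ c ^ σ n * p ^ a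
  prime-power-factor {p} {m} {n} p-prime p∣n p∤m m∣n a with p ≤? 2 ^ r
  ... | yes p≤2^r = begin
    suc a ^ r * c ^ σ m      ≤⟨ *-monoˡ-≤ (c ^ σ m) (≤-trans (poly≤exp a) (*-monoʳ-≤ c (^-monoˡ-≤ a 2≤p))) ⟩
    c * p ^ a * c ^ σ m      ≡⟨ regroup c (p ^ a) (c ^ σ m) ⟩
    c ^ suc (σ m) * p ^ a    ≤⟨ *-monoˡ-≤ (p ^ a) (^-monoʳ-≤ c (σ-strict p-prime p≤2^r p∣n p∤m m∣n)) ⟩
    c ^ σ n * p ^ a          ∎
    where
    open ≤-Reasoning
    2≤p = prime⇒1<p p-prime
    regroup : ∀ x y z → x * y * z ≡ x * z * y
    regroup = solve-∀
  ... | no p≰2^r = begin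
    suc a ^ r * c ^ σ m      ≤⟨ *-mono-≤ [1+a]^r≤p^a (^-monoʳ-≤ c (σ-mono m∣n)) ⟩
    p ^ a * c ^ σ n          ≡⟨ *-comm (p ^ a) (c ^ σ n) ⟩
    c ^ σ n * p ^ a          ∎
    where
    open ≤-Reasoning
    [1+a]^r≤p^a : suc a ^ r ≤ p ^ a
    [1+a]^r≤p^a = begin
      suc a ^ r    ≤⟨ ^-monoˡ-≤ r (1+n≤2^n a) ⟩
      (2 ^ a) ^ r  ≡⟨ ^-*-assoc 2 a r ⟩
      2 ^ (a * r)  ≡⟨ cong (2 ^_) (*-comm a r) ⟩
      2 ^ (r * a)  ≡⟨ ^-*-assoc 2 r a ⟨
      (2 ^ r) ^ a  ≤⟨ ^-monoˡ-≤ a (<⇒≤ (≰⇒> p≰2^r)) ⟩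
      p ^ a        ∎

  τ^r≤c^σ*n : ∀ n .{{_ : NonZero n}} → τ n ^ r ≤ c ^ σ n * n
  τ^r≤c^σ*n = <-rec Bound bound
    where
    Bound : ℕ → Set
    Bound n = .{{NonZero n}} → τ n ^ r ≤ c ^ σ n * n
    bound : ∀ n → (∀ {k} → k < n → Bound k) → Bound n
    bound (suc zero) _ = begin
      1 ^ r            ≡⟨ ^-zeroˡ r ⟩
      1                ≤⟨ m^n>0 c (σ 1) ⟩
      c ^ σ 1          ≡⟨ *-identityʳ (c ^ σ 1) ⟨
      c ^ σ 1 * 1      ∎
      where open ≤-Reasoning
    bound n@(suc (suc _)) rec with ∃-prime-divisor n (s≤s (s≤s z≤n))
    ... | p , p-prime , p∣n with p-adic-split (prime⇒1<p p-prime) n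
    ...   | zero  , m , p∤m , n≡m+0 = contradiction (subst (p ∣_) (trans n≡m+0 (+-identityʳ m)) p∣n) p∤m
    ...   | suc a , m , p∤m , n≡p^[1+a]*m = begin
      τ n ^ r                           ≡⟨ cong (λ x → τ x ^ r) n≡p^[1+a]*m ⟩
      τ (P * m) ^ r                     ≤⟨ ^-monoˡ-≤ r (τ[p^a*m]≤[1+a]*τ[m] p-prime (suc a) m) ⟩
      (suc (suc a) * τ m) ^ r           ≡⟨ ^-distribʳ-* (suc (suc a)) (τ m) r ⟩
      suc (suc a) ^ r * τ m ^ r         ≤⟨ *-monoʳ-≤ (suc (suc a) ^ r) (rec m<n) ⟩
      suc (suc a) ^ r * (c ^ σ m * m)   ≡⟨ *-assoc (suc (suc a) ^ r) (c ^ σ m) m ⟨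
      suc (suc a) ^ r * c ^ σ m * m     ≤⟨ *-monoˡ-≤ m (prime-power-factor p-prime p∣n p∤m m∣n (suc a)) ⟩
      c ^ σ n * P * m                   ≡⟨ *-assoc (c ^ σ n) P m ⟩
      c ^ σ n * (P * m)                 ≡⟨ cong (c ^ σ n *_) n≡p^[1+a]*m ⟨
      c ^ σ n * n                       ∎
      where
      open ≤-Reasoning
      P = p ^ suc a
      instance
        m≢0 : NonZero m
        m≢0 = m*n≢0⇒n≢0 P {{subst NonZero n≡p^[1+a]*m _}}
      m∣n : m ∣ n
      m∣n = divides P n≡p^[1+a]*m
      m<n : m < n
      m<n = subst (m <_) (sym n≡p^[1+a]*m) (m<p^[1+a]*m (prime⇒1<p p-prime) a m)

divisor-bound : ∀ r → ∃ λ D → ∀ n .{{_ : NonZero n}} → τ n ^ r ≤ D * n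
divisor-bound r with [1+a]^r≤c*2^a r
... | c , c≢0 , poly≤exp = c ^ 2 ^ r , λ n →
  ≤-trans (τ^r≤c^σ*n n) (*-monoˡ-≤ n (^-monoʳ-≤ c (count≤ (primeDivisor? n) (2 ^ r))))
  where
  instance _ = c≢0
  open DivisorBound r c poly≤exp

maxτ : ℕ → ℕ
maxτ zero    = 0
maxτ (suc B) = maxτ B ⊔ τ (suc B)

τ≤maxτ : ∀ {n B} → 1 ≤ n → n ≤ B → τ n ≤ maxτ B
τ≤maxτ {n} {zero}  1≤n n≤0 = contradiction (≤-trans 1≤n n≤0) λ ()
τ≤maxτ {n} {suc B} 1≤n n≤1+B with n ≟ suc B
... | yes refl    = m≤n⊔m (maxτ B) (τ (suc B))
... | no  n≢1+B = ≤-trans (τ≤maxτ 1≤n (≤-pred (≤∧≢⇒< n≤1+B n≢1+B))) (m≤m⊔n (maxτ B) (τ (suc B)))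

maxτ-bound : ∀ {k D} → (∀ n .{{_ : NonZero n}} → τ n ^ suc k ≤ D * n) → ∀ B → maxτ B ^ suc k ≤ D * B
maxτ-bound τ-bound zero    = z≤n
maxτ-bound {k} {D} τ-bound (suc B) with ⊔-sel (maxτ B) (τ (suc B))
... | inj₁ eq rewrite eq = ≤-trans (maxτ-bound {k} {D} τ-bound B) (*-monoʳ-≤ D (n≤1+n B))
... | inj₂ eq rewrite eq = τ-bound (suc B)

-- Integrality of U

isInt⇒integral : ∀ q → T (isInt q) → toℚᵘ q ≡ mkℚᵘ (↥ q) 0
isInt⇒integral (mkℚ _ zero    _) _  = refl
isInt⇒integral (mkℚ _ (suc _) _) ()

isInt-⊔ : ∀ p q → T (isInt (p ℚ.⊔ q)) → T (isInt p) ⊎ T (isInt q)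
isInt-⊔ p q int with ℚ.⊔-sel p q
... | inj₁ p⊔q≡p = inj₁ (subst (T ∘ isInt) p⊔q≡p int)
... | inj₂ p⊔q≡q = inj₂ (subst (T ∘ isInt) p⊔q≡q int)

toℚᵘ[x/m-y/n] : ∀ x i y j → toℚᵘ (x ℚ./ suc i ℚ.- y ℚ./ suc j) ≃ᵘ mkℚᵘ x i ℚᵘ.- mkℚᵘ y j
toℚᵘ[x/m-y/n] x i y j = ℚᵘ.≃-trans (ℚ.toℚᵘ-homo-+ (x ℚ./ suc i) (ℚ.- (y ℚ./ suc j)))
  (ℚᵘ.+-cong (ℚ.toℚᵘ-fromℚᵘ (mkℚᵘ x i))
             (ℚᵘ.≃-trans (ℚ.toℚᵘ-homo‿- (y ℚ./ suc j)) (ℚᵘ.-‿cong (ℚ.toℚᵘ-fromℚᵘ (mkℚᵘ y j)))))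

÷ℕ-integral : ∀ q v .{{_ : NonZero v}} {z w} → toℚᵘ q ≃ᵘ mkℚᵘ z w →
              T (isInt (q ÷ℕ v)) → ∃ λ t → z ≡ t ℤ.* + v
÷ℕ-integral q v@(suc v-1) {z} {w} q≃z/w int = ↥ t ℤ.* + suc w , cross-multiply t≃z/w*1/v
  where
  t = q ÷ℕ v
  t≃z/w*1/v : mkℚᵘ (↥ t) 0 ≃ᵘ mkℚᵘ z w ℚᵘ.* mkℚᵘ (+ 1) v-1
  t≃z/w*1/v = ℚᵘ.≃-trans (ℚᵘ.≃-reflexive (sym (isInt⇒integral t int)))
    (ℚᵘ.≃-trans (ℚ.toℚᵘ-homo-* q (+ 1 ℚ./ v)) (ℚᵘ.*-cong q≃z/w (ℚ.toℚᵘ-fromℚᵘ (mkℚᵘ (+ 1) v-1))))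
  cross-multiply : mkℚᵘ (↥ t) 0 ≃ᵘ mkℚᵘ z w ℚᵘ.* mkℚᵘ (+ 1) v-1 → z ≡ ↥ t ℤ.* + suc w ℤ.* + v
  cross-multiply (*≡* eq) = begin
    z                                 ≡⟨ z≡z*1*1 z ⟩
    z ℤ.* + 1 ℤ.* + 1                 ≡⟨ eq ⟨
    ↥ t ℤ.* + (suc w * v)             ≡⟨ cong (↥ t ℤ.*_) (ℤ.pos-* (suc w) v) ⟩
    ↥ t ℤ.* (+ suc w ℤ.* + v)         ≡⟨ ℤ.*-assoc (↥ t) (+ suc w) (+ v) ⟨
    ↥ t ℤ.* + suc w ℤ.* + v           ∎
    where
    open ≡-Reasoning
    z≡z*1*1 : ∀ z → z ≡ z ℤ.* + 1 ℤ.* + 1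
    z≡z*1*1 = ℤ.solve-∀

∣m⊖n∣≡∣m-n∣ : ∀ m n → ℤ.∣ m ℤ.⊖ n ∣ ≡ ∣ m - n ∣
∣m⊖n∣≡∣m-n∣ zero    zero    = refl
∣m⊖n∣≡∣m-n∣ zero    (suc n) = refl
∣m⊖n∣≡∣m-n∣ (suc m) zero    = refl
∣m⊖n∣≡∣m-n∣ (suc m) (suc n) = trans (cong ℤ.∣_∣ (ℤ.[1+m]⊖[1+n]≡m⊖n m n)) (∣m⊖n∣≡∣m-n∣ m n)

+m-+n≡t*+d⇒d∣∣m-n∣ : ∀ m n {d} t → + m ℤ.- + n ≡ t ℤ.* + d → d ∣ ∣ m - n ∣
+m-+n≡t*+d⇒d∣∣m-n∣ m n {d} t eq = divides ℤ.∣ t ∣ (begin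
  ∣ m - n ∣              ≡⟨ ∣m⊖n∣≡∣m-n∣ m n ⟨
  ℤ.∣ m ℤ.⊖ n ∣          ≡⟨ cong ℤ.∣_∣ (ℤ.m-n≡m⊖n m n) ⟨
  ℤ.∣ + m ℤ.- + n ∣      ≡⟨ cong ℤ.∣_∣ eq ⟩
  ℤ.∣ t ℤ.* + d ∣        ≡⟨ ℤ.abs-* t (+ d) ⟩
  ℤ.∣ t ∣ * d            ∎)
  where open ≡-Reasoning

%-≡⇒∣∣-∣ : ∀ m n d .{{_ : NonZero d}} → m % d ≡ n % d → d ∣ ∣ m - n ∣
%-≡⇒∣∣-∣ m n d eq = divides ∣ m / d - n / d ∣ (begin
  ∣ m - n ∣                                     ≡⟨ cong₂ ∣_-_∣ (m≡m%n+[m/n]*n m d)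
                                                     (trans (m≡m%n+[m/n]*n n d) (cong (_+ n / d * d) (sym eq))) ⟩
  ∣ m % d + m / d * d - m % d + n / d * d ∣     ≡⟨ ∣m+n-m+o∣≡∣n-o∣ (m % d) (m / d * d) (n / d * d) ⟩
  ∣ m / d * d - n / d * d ∣                     ≡⟨ *-distribʳ-∣-∣ d (m / d) (n / d) ⟨
  ∣ m / d - n / d ∣ * d                         ∎)
  where open ≡-Reasoning

∣∣1-b∣⇒b≡1 : ∀ {u b} → 1 ≤ b → b ≤ u → u ∣ ∣ 1 - b ∣ → b ≡ 1
∣∣1-b∣⇒b≡1 {b = suc zero}    _ _   _         = refl
∣∣1-b∣⇒b≡1 {b = suc (suc b)} _ b≤u u∣[1+b] = contradiction (∣⇒≤ u∣[1+b]) (<⇒≱ b≤u)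

firstWith-found : ∀ p xs d → T (p (firstWith p xs d)) ⊎ firstWith p xs d ≡ d
firstWith-found p []       d = inj₂ refl
firstWith-found p (x ∷ xs) d with p x in px
... | true  = inj₁ (subst T (sym px) tt)
... | false = firstWith-found p xs d

firstWith-pres : ∀ {P : Pred ℕ ℓ} p xs d → All P xs → P d → P (firstWith p xs d)
firstWith-pres p []       d []         Pd = Pd
firstWith-pres p (x ∷ xs) d (Px ∷ Pxs) Pd with p x
... | true  = Px
... | false = firstWith-pres p xs d Pxs Pd

b₀∈[1,u] : ∀ κ k u v .{{_ : NonZero u}} → 1 ≤ b₀ κ k u v × b₀ κ k u v ≤ u
b₀∈[1,u] κ k u v = helper κ
  where
  range1⊆[1,u] : All (λ x → 1 ≤ x × x ≤ u) (range1 u)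
  range1⊆[1,u] = All.map⁺ (All.applyUpTo⁺₁ (λ i → i) u (λ i<u → s≤s z≤n , i<u))
  u∈[1,u] : 1 ≤ u × u ≤ u
  u∈[1,u] = >-nonZero⁻¹ u , ≤-refl
  helper : ∀ κ → 1 ≤ b₀ κ k u v × b₀ κ k u v ≤ u
  helper additive   = firstWith-pres _ (range1 u) u range1⊆[1,u] u∈[1,u]
  helper difference = firstWith-pres _ (range1 u) u range1⊆[1,u] u∈[1,u]

isInt[1-b₀/u]⇒b₀≡1 : ∀ κ k u v .{{_ : NonZero u}} →
                     T (isInt ((ℤℚ 1 ℚ.- ℤℚ (b₀ κ k u v)) ÷ℕ u)) → b₀ κ k u v ≡ 1
isInt[1-b₀/u]⇒b₀≡1 κ k u v int =
  let t , eq = ÷ℕ-integral _ u (toℚᵘ[x/m-y/n] (+ 1) 0 (+ b) 0) int in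
  ∣∣1-b∣⇒b≡1 (proj₁ (b₀∈[1,u] κ k u v)) (proj₂ (b₀∈[1,u] κ k u v))
    (+m-+n≡t*+d⇒d∣∣m-n∣ 1 b t (trans (x-y≡x*1+[-y]*1 (+ 1) (+ b)) eq))
  where
  b = b₀ κ k u v
  x-y≡x*1+[-y]*1 : ∀ x y → x ℤ.- y ≡ x ℤ.* + 1 ℤ.+ (ℤ.- y) ℤ.* + 1
  x-y≡x*1+[-y]*1 = ℤ.solve-∀

-- When b₀ is the fallback value u of firstWith, b₀ ≡ 1 forces u ≡ 1, which divides everything.
module _ (k u v : ℕ) .{{_ : NonZero u}} where

  b₀≡1⇒u∣∣v-k∣ : b₀ additive k u v ≡ 1 → u ∣ ∣ v - k ∣
  b₀≡1⇒u∣∣v-k∣ b≡1 with firstWith-found (λ b → b * v % u ≡ᵇ k % u) (range1 u) u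
  ... | inj₁ found = subst (λ x → u ∣ ∣ x - k ∣) (+-identityʳ v)
                       (%-≡⇒∣∣-∣ (1 * v) k u (≡ᵇ⇒≡ _ _ (subst (λ b → T (b * v % u ≡ᵇ k % u)) b≡1 found)))
  ... | inj₂ b≡u   = subst (_∣ ∣ v - k ∣) (trans (sym b≡1) b≡u) (1∣ _)

  b₀≡1⇒u∣v+k : b₀ difference k u v ≡ 1 → u ∣ v + k
  b₀≡1⇒u∣v+k b≡1 with firstWith-found (λ b → (b * v + k) % u ≡ᵇ 0) (range1 u) u
  ... | inj₁ found = subst (λ x → u ∣ x + k) (+-identityʳ v)
                       (m%n≡0⇒n∣m (1 * v + k) u (≡ᵇ⇒≡ _ _ (subst (λ b → T ((b * v + k) % u ≡ᵇ 0)) b≡1 found)))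
  ... | inj₂ b≡u   = subst (_∣ v + k) (trans (sym b≡1) b≡u) (1∣ _)

module _ (N k i v : ℕ) .{{_ : NonZero v}} where

  isInt[a₀-N/v]⇒v∣∣k-Nu∣ : T (isInt ((a₀ additive k (suc i) v ℚ.- ℤℚ N) ÷ℕ v)) → v ∣ ∣ k - N * suc i ∣
  isInt[a₀-N/v]⇒v∣∣k-Nu∣ int =
    let t , eq = ÷ℕ-integral _ v (toℚᵘ[x/m-y/n] (+ k ℤ.- + (b * v)) i (+ N) 0) int in
    +m-+n≡t*+d⇒d∣∣m-n∣ k (N * suc i) (t ℤ.+ + b) (begin
      + k ℤ.- + (N * suc i)                                                ≡⟨ cong (ℤ._-_ (+ k)) (ℤ.pos-* N (suc i)) ⟩
      + k ℤ.- + N ℤ.* + suc i                                              ≡⟨ rearrange (+ k) (+ (b * v)) (+ N) (+ suc i) ⟩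
      (+ k ℤ.- + (b * v)) ℤ.* + 1 ℤ.+ (ℤ.- + N) ℤ.* + suc i ℤ.+ + (b * v)  ≡⟨ cong₂ ℤ._+_ eq (ℤ.pos-* b v) ⟩
      t ℤ.* + v ℤ.+ + b ℤ.* + v                                            ≡⟨ ℤ.*-distribʳ-+ (+ v) t (+ b) ⟨
      (t ℤ.+ + b) ℤ.* + v                                                  ∎)
    where
    open ≡-Reasoning
    b = b₀ additive k (suc i) v
    rearrange : ∀ x y n u → x ℤ.- n ℤ.* u ≡ (x ℤ.- y) ℤ.* + 1 ℤ.+ (ℤ.- n) ℤ.* u ℤ.+ y
    rearrange = ℤ.solve-∀

  isInt[1-a₀/v]⇒v∣∣u-k∣ : T (isInt ((ℤℚ 1 ℚ.- a₀ difference k (suc i) v) ÷ℕ v)) → v ∣ ∣ suc i - k ∣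
  isInt[1-a₀/v]⇒v∣∣u-k∣ int =
    let t , eq = ÷ℕ-integral _ v (toℚᵘ[x/m-y/n] (+ 1) 0 (+ k ℤ.+ + (b * v)) i) int in
    +m-+n≡t*+d⇒d∣∣m-n∣ (suc i) k (t ℤ.+ + b) (begin
      + suc i ℤ.- + k                                                      ≡⟨ rearrange (+ k) (+ (b * v)) (+ suc i) ⟩
      + 1 ℤ.* + suc i ℤ.+ (ℤ.- (+ k ℤ.+ + (b * v))) ℤ.* + 1 ℤ.+ + (b * v)  ≡⟨ cong₂ ℤ._+_ eq (ℤ.pos-* b v) ⟩
      t ℤ.* + v ℤ.+ + b ℤ.* + v                                            ≡⟨ ℤ.*-distribʳ-+ (+ v) t (+ b) ⟨
      (t ℤ.+ + b) ℤ.* + v                                                  ∎)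
    where
    open ≡-Reasoning
    b = b₀ difference k (suc i) v
    rearrange : ∀ x y u → u ℤ.- x ≡ + 1 ℤ.* u ℤ.+ (ℤ.- (x ℤ.+ y)) ℤ.* + 1 ℤ.+ y
    rearrange = ℤ.solve-∀

modulusᵤ modulusᵥ : Kind → (N k : ℕ) → ℕ → ℕ
modulusᵤ additive   N k v = ∣ v - k ∣
modulusᵤ difference N k v = v + k
modulusᵥ additive   N k u = ∣ k - N * u ∣
modulusᵥ difference N k u = ∣ u - k ∣

isInt-UU⇒∣ : ∀ κ N k u v .{{_ : NonZero u}} .{{_ : NonZero v}} →
             T (isInt (UU κ N k u v)) → u ∣ modulusᵤ κ N k v ⊎ v ∣ modulusᵥ κ N k u
isInt-UU⇒∣ additive N k u@(suc i) v int
  with isInt-⊔ ((ℤℚ 1 ℚ.- ℤℚ (b₀ additive k u v)) ÷ℕ u) ((a₀ additive k u v ℚ.- ℤℚ N) ÷ℕ v) int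
... | inj₁ int₁ = inj₁ (b₀≡1⇒u∣∣v-k∣ k u v (isInt[1-b₀/u]⇒b₀≡1 additive k u v int₁))
... | inj₂ int₂ = inj₂ (isInt[a₀-N/v]⇒v∣∣k-Nu∣ N k i v int₂)
isInt-UU⇒∣ difference N k u@(suc i) v int
  with isInt-⊔ ((ℤℚ 1 ℚ.- a₀ difference k u v) ÷ℕ v) ((ℤℚ 1 ℚ.- ℤℚ (b₀ difference k u v)) ÷ℕ u) int
... | inj₁ int₁ = inj₂ (isInt[1-a₀/v]⇒v∣∣u-k∣ N k i v int₁)
... | inj₂ int₂ = inj₁ (b₀≡1⇒u∣v+k k u v (isInt[1-b₀/u]⇒b₀≡1 difference k u v int₂))

-- Counting the pairs (u, v)

AtMostOneZero : (ℕ → ℕ) → Set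
AtMostOneZero g = ∀ {x y} → g x ≡ 0 → g y ≡ 0 → x ≡ y

modulusᵤ-atMostOneZero : ∀ κ N k → AtMostOneZero (modulusᵤ κ N k)
modulusᵤ-atMostOneZero additive   N k         x≡k   y≡k   = trans (∣m-n∣≡0⇒m≡n x≡k) (sym (∣m-n∣≡0⇒m≡n y≡k))
modulusᵤ-atMostOneZero difference N k {x} {y} x+k≡0 y+k≡0 = trans (m+n≡0⇒m≡0 x x+k≡0) (sym (m+n≡0⇒m≡0 y y+k≡0))

modulusᵥ-atMostOneZero : ∀ κ N k .{{_ : NonZero N}} → AtMostOneZero (modulusᵥ κ N k)
modulusᵥ-atMostOneZero additive   N k {x} {y} k≡Nx k≡Ny =
  *-cancelˡ-≡ x y N (trans (sym (∣m-n∣≡0⇒m≡n {k} k≡Nx)) (∣m-n∣≡0⇒m≡n {k} k≡Ny))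
modulusᵥ-atMostOneZero difference N k x≡k y≡k = trans (∣m-n∣≡0⇒m≡n x≡k) (sym (∣m-n∣≡0⇒m≡n y≡k))

module _ (N k : ℕ) .{{_ : NonZero N}} (k≤2N² : k ≤ 2 * (N * N)) where

  modulusᵤ≤3N² : ∀ κ {x} → x ≤ N → modulusᵤ κ N k x ≤ 3 * (N * N)
  modulusᵤ≤3N² additive   {x} x≤N = ≤-trans (∣m-n∣≤m+n x k) (+-mono-≤ (m≤n⇒m≤n*o N x≤N) k≤2N²)
  modulusᵤ≤3N² difference {x} x≤N = +-mono-≤ (m≤n⇒m≤n*o N x≤N) k≤2N²

  modulusᵥ≤3N² : ∀ κ {x} → x ≤ N → modulusᵥ κ N k x ≤ 3 * (N * N)
  modulusᵥ≤3N² additive   {x} x≤N = begin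
    ∣ k - N * x ∣   ≡⟨ ∣-∣-comm k (N * x) ⟩
    ∣ N * x - k ∣   ≤⟨ ∣m-n∣≤m+n (N * x) k ⟩
    N * x + k       ≤⟨ +-mono-≤ (*-monoʳ-≤ N x≤N) k≤2N² ⟩
    3 * (N * N)     ∎
    where open ≤-Reasoning
  modulusᵥ≤3N² difference {x} x≤N = ≤-trans (∣m-n∣≤m+n x k) (+-mono-≤ (m≤n⇒m≤n*o N x≤N) k≤2N²)

count-divisors≤ : ∀ {n B} M → n ≤ B → count (_∣? n) M ≤ maxτ B + M * ind (does (n ≟ 0))
count-divisors≤ {zero}  {B} M _   =
  ≤-trans (count≤ (_∣? 0) M) (≤-trans (≤-reflexive (sym (*-identityʳ M))) (m≤n+m (M * 1) (maxτ B)))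
count-divisors≤ {suc n} {B} M n≤B =
  ≤-trans (divisors≤τ M) (≤-trans (τ≤maxτ (s≤s z≤n) n≤B) (m≤m+n (maxτ B) (M * 0)))

-- A zero value g x = 0 has M divisors in [1, M] instead of at most maxτ B; it can occur only once.
∑count-divisors≤ : ∀ B M (g : ℕ → ℕ) → (∀ {x} → x ≤ M → g x ≤ B) → AtMostOneZero g →
                   ∑< M (λ i → count (_∣? g (suc i)) M) ≤ M * maxτ B + M
∑count-divisors≤ B M g g≤B g-atMostOneZero = begin
  ∑< M (λ i → count (_∣? g (suc i)) M)                 ≤⟨ ∑<-mono-≤ M (λ i<M → count-divisors≤ M (g≤B i<M)) ⟩
  ∑< M (λ i → maxτ B + M * [g≡0] (suc i))                ≡⟨ ∑<-distrib-+ M (λ _ → maxτ B) _ ⟩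
  ∑< M (λ _ → maxτ B) + ∑< M (λ i → M * [g≡0] (suc i))   ≡⟨ cong₂ _+_ (∑<-const M (maxτ B)) (sym (*-distribˡ-∑< M M _)) ⟩
  M * maxτ B + M * count (λ x → g x ≟ 0) M              ≤⟨ +-monoʳ-≤ (M * maxτ B) (*-monoʳ-≤ M one-zero) ⟩
  M * maxτ B + M * 1                                    ≡⟨ cong (_+_ (M * maxτ B)) (*-identityʳ M) ⟩
  M * maxτ B + M                                        ∎
  where
  open ≤-Reasoning
  [g≡0] : ℕ → ℕ
  [g≡0] x = ind (does (g x ≟ 0))
  one-zero : count (λ x → g x ≟ 0) M ≤ 1
  one-zero = count-atMostOne (λ x → g x ≟ 0) g-atMostOneZero M

∑∑isInt-UU≤ : ∀ κ {N k M} .{{_ : NonZero N}} → k ≤ 2 * (N * N) → M ≤ N →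
  ∑< M (λ i → ∑< M (λ j → ind (isInt (UU κ N k (suc i) (suc j))))) ≤ 2 * (M * maxτ (3 * (N * N)) + M)
∑∑isInt-UU≤ κ {N} {k} {M} k≤2N² M≤N = begin
  ∑< M (λ i → ∑< M (λ j → ind (isInt (UU κ N k (suc i) (suc j)))))
    ≤⟨ ∑<-mono-≤ M (λ {i} _ → ∑<-mono-≤ M (λ {j} _ →
         ind-⊎ _ (suc i ∣? modulusᵤ κ N k (suc j)) (suc j ∣? modulusᵥ κ N k (suc i)) (isInt-UU⇒∣ κ N k (suc i) (suc j)))) ⟩
  ∑< M (λ i → ∑< M (λ j → ∣ᵤ i j + ∣ᵥ i j))
    ≡⟨ trans (∑<-cong M (λ i → ∑<-distrib-+ M (∣ᵤ i) (∣ᵥ i))) (∑<-distrib-+ M _ _) ⟩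
  ∑< M (λ i → ∑< M (∣ᵤ i)) + ∑< M (λ i → ∑< M (∣ᵥ i))
    ≡⟨ cong (_+ ∑< M (λ i → ∑< M (∣ᵥ i))) (∑<-comm M M ∣ᵤ) ⟩
  ∑< M (λ j → count (_∣? modulusᵤ κ N k (suc j)) M) + ∑< M (λ i → count (_∣? modulusᵥ κ N k (suc i)) M)
    ≤⟨ +-mono-≤ (∑count-divisors≤ _ M _ (λ x≤M → modulusᵤ≤3N² N k k≤2N² κ (≤-trans x≤M M≤N)) (modulusᵤ-atMostOneZero κ N k))
                (∑count-divisors≤ _ M _ (λ x≤M → modulusᵥ≤3N² N k k≤2N² κ (≤-trans x≤M M≤N)) (modulusᵥ-atMostOneZero κ N k)) ⟩
  (M * τₘₐₓ + M) + (M * τₘₐₓ + M)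
    ≡⟨ cong (_+_ (M * τₘₐₓ + M)) (+-identityʳ (M * τₘₐₓ + M)) ⟨
  2 * (M * τₘₐₓ + M) ∎
  where
  open ≤-Reasoning
  τₘₐₓ = maxτ (3 * (N * N))
  ∣ᵤ ∣ᵥ : ℕ → ℕ → ℕ
  ∣ᵤ i j = ind (does (suc i ∣? modulusᵤ κ N k (suc j)))
  ∣ᵥ i j = ind (does (suc j ∣? modulusᵥ κ N k (suc i)))

Weight : Set
Weight = (d u v : ℕ) → .{{_ : NonZero d}} → .{{_ : NonZero u}} → .{{_ : NonZero v}} → ℕ

coprimePairSum : ℕ → (ℕ → ℕ → ℕ) → ℕ
coprimePairSum M f =
  sum (map (λ i → sum (map (λ j → if gcd (suc i) (suc j) ≡ᵇ 1 then f i j else 0) (upTo M))) (upTo M))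

coprimePairSum≤∑∑ : ∀ M f → coprimePairSum M f ≤ ∑< M (λ i → ∑< M (f i))
coprimePairSum≤∑∑ M f = begin
  coprimePairSum M f                                ≤⟨ sum-map-mono-≤ (upTo M) (λ i → sum-map-mono-≤ (upTo M) (λ j → if≤ _ (f i j))) ⟩
  sum (map (λ i → sum (map (f i) (upTo M))) (upTo M)) ≡⟨ sum-map-upTo _ M ⟩
  ∑< M (λ i → sum (map (f i) (upTo M)))             ≡⟨ ∑<-cong M (λ i → sum-map-upTo (f i) M) ⟩
  ∑< M (λ i → ∑< M (f i))                           ∎
  where
  open ≤-Reasoning
  if≤ : ∀ c x → (if c then x else 0) ≤ x
  if≤ true  x = ≤-refl
  if≤ false x = z≤n

DUVSum-mono-≤ : ∀ N h (w w′ : Weight) →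
  (∀ d u v → w (suc d) (suc u) (suc v) ≤ w′ (suc d) (suc u) (suc v)) → DUVSum N h w ≤ DUVSum N h w′
DUVSum-mono-≤ N h w w′ w≤w′ = sum-map-mono-≤ (upTo N) λ d → if-mono-≤ (does (suc d ∣? h))
  (sum-map-mono-≤ (upTo (N / suc d)) λ u → sum-map-mono-≤ (upTo (N / suc d)) λ v →
    if-mono-≤ (gcd (suc u) (suc v) ≡ᵇ 1) (w≤w′ d u v))

DUVSum≤ : ∀ N h K (w : Weight) →
  (∀ d → suc d ∣ h → ∑< (N / suc d) (λ i → ∑< (N / suc d) (λ j → w (suc d) (suc i) (suc j))) ≤ K) →
  DUVSum N h w ≤ K * count (_∣? h) N
DUVSum≤ N h K w bound = begin
  DUVSum N h w                                          ≤⟨ sum-map-mono-≤ (upTo N) per-divisor ⟩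
  sum (map (λ d → K * ind (does (suc d ∣? h))) (upTo N)) ≡⟨ sum-map-upTo _ N ⟩
  ∑< N (λ d → K * ind (does (suc d ∣? h)))              ≡⟨ *-distribˡ-∑< K N _ ⟨
  K * count (_∣? h) N                                   ∎
  where
  open ≤-Reasoning
  per-divisor : ∀ d → (if does (suc d ∣? h) then coprimePairSum (N / suc d) (λ i j → w (suc d) (suc i) (suc j)) else 0)
                      ≤ K * ind (does (suc d ∣? h))
  per-divisor d = by-cases (suc d ∣? h)
    where
    by-cases : (d∣?h : Dec (suc d ∣ h)) →
               (if does d∣?h then coprimePairSum (N / suc d) (λ i j → w (suc d) (suc i) (suc j)) else 0)
               ≤ K * ind (does d∣?h)
    by-cases (yes d∣h) = ≤-trans (coprimePairSum≤∑∑ (N / suc d) (λ i j → w (suc d) (suc i) (suc j)))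
                                 (≤-trans (bound d d∣h) (m≤m*n K 1))
    by-cases (no  _)   = z≤n

Sum₁≤Sum₂ : ∀ κ N h → Sum₁ κ N h ≤ Sum₂ κ N h
Sum₁≤Sum₂ κ N h = DUVSum-mono-≤ N h
  (λ d u v → ind (isInt (UU κ N (h / d) u v)) * ind (UU κ N (h / d) u v ℚ.≤ᵇ VV κ N (h / d) u v))
  (λ d u v → ind (isInt (UU κ N (h / d) u v)))
  (λ d u v → ind*ind≤ind (isInt (UU κ N (h / suc d) (suc u) (suc v))) _)
  where
  ind*ind≤ind : ∀ a b → ind a * ind b ≤ ind a
  ind*ind≤ind true  true  = ≤-refl
  ind*ind≤ind true  false = z≤n
  ind*ind≤ind false _     = z≤n

1≤h≤2N²⇒N≢0 : ∀ {N h} → 1 ≤ h → h ≤ 2 * (N * N) → NonZero N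
1≤h≤2N²⇒N≢0 {zero}  1≤h h≤0 = contradiction (≤-trans 1≤h h≤0) λ ()
1≤h≤2N²⇒N≢0 {suc N} _   _   = _

Sum₂≤4N*maxτ² : ∀ κ N h → 1 ≤ h → h ≤ 2 * (N * N) →
                let τₘₐₓ = maxτ (3 * (N * N)) in Sum₂ κ N h ≤ 4 * N * (τₘₐₓ * τₘₐₓ)
Sum₂≤4N*maxτ² κ N h 1≤h h≤2N² = begin
  Sum₂ κ N h                            ≤⟨ DUVSum≤ N h (2 * (N * τₘₐₓ + N)) weight per-divisor ⟩
  2 * (N * τₘₐₓ + N) * count (_∣? h) N  ≤⟨ *-mono-≤ (*-monoʳ-≤ 2 (+-monoʳ-≤ (N * τₘₐₓ) N≤N*τₘₐₓ)) divisors-of-h≤τₘₐₓ ⟩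
  2 * (N * τₘₐₓ + N * τₘₐₓ) * τₘₐₓ      ≡⟨ regroup N τₘₐₓ ⟩
  4 * N * (τₘₐₓ * τₘₐₓ)                 ∎
  where
  open ≤-Reasoning
  instance _ = 1≤h≤2N²⇒N≢0 1≤h h≤2N²
  τₘₐₓ = maxτ (3 * (N * N))
  weight : Weight
  weight d u v = ind (isInt (UU κ N (h / d) u v))
  h≤3N² : h ≤ 3 * (N * N)
  h≤3N² = ≤-trans h≤2N² (m≤n+m _ (N * N))
  divisors-of-h≤τₘₐₓ : count (_∣? h) N ≤ τₘₐₓ
  divisors-of-h≤τₘₐₓ = ≤-trans (divisors≤τ {{>-nonZero 1≤h}} N) (τ≤maxτ 1≤h h≤3N²)
  N≤N*τₘₐₓ : N ≤ N * τₘₐₓ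
  N≤N*τₘₐₓ = m≤m*n N τₘₐₓ {{>-nonZero (τ≤maxτ {1} ≤-refl (≤-trans 1≤h h≤3N²))}}
  per-divisor : ∀ d → suc d ∣ h → ∑< (N / suc d) (λ i → ∑< (N / suc d) (λ j →
                  ind (isInt (UU κ N (h / suc d) (suc i) (suc j))))) ≤ 2 * (N * τₘₐₓ + N)
  per-divisor d _ = ≤-trans (∑∑isInt-UU≤ κ (≤-trans (m/n≤m h (suc d)) h≤2N²) (m/n≤m N (suc d)))
                            (*-monoʳ-≤ 2 (+-mono-≤ (*-monoˡ-≤ τₘₐₓ (m/n≤m N (suc d))) (m/n≤m N (suc d))))
  regroup : ∀ N τₘₐₓ → 2 * (N * τₘₐₓ + N * τₘₐₓ) * τₘₐₓ ≡ 4 * N * (τₘₐₓ * τₘₐₓ)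
  regroup = solve-∀

-- (S^r)² ≤ (16 N² t⁴)^r ≤ 16^r N^(2r) · 3 D N², and 16^r · 3 D ≤ C^r ≤ (C^r)² for C = 48 (D + 1).
S^r≤C^r*N^[1+r] : ∀ S N t D r → S ≤ 4 * N * (t * t) → t ^ (4 * suc r) ≤ D * (3 * (N * N)) →
                  S ^ suc r ≤ (48 * suc D) ^ suc r * N ^ suc (suc r)
S^r≤C^r*N^[1+r] S N t D r S≤4Nt² t^4r≤3DN² = m*m≤n*n⇒m≤n (begin
  S ^ R * S ^ R                                    ≡⟨ ^-distribʳ-* S S R ⟨
  (S * S) ^ R                                      ≤⟨ ^-monoˡ-≤ R (*-mono-≤ S≤4Nt² S≤4Nt²) ⟩
  (4 * N * (t * t) * (4 * N * (t * t))) ^ R        ≡⟨ cong (_^ R) (square-4Nt² N t) ⟩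
  (16 * (N * N) * t ^ 4) ^ R                       ≡⟨ ^-distribʳ-* (16 * (N * N)) (t ^ 4) R ⟩
  (16 * (N * N)) ^ R * (t ^ 4) ^ R                 ≡⟨ cong₂ _*_ (^-distribʳ-* 16 (N * N) R) (^-*-assoc t 4 R) ⟩
  16 ^ R * (N * N) ^ R * t ^ (4 * R)               ≤⟨ *-monoʳ-≤ (16 ^ R * (N * N) ^ R) t^4r≤3DN² ⟩
  16 ^ R * (N * N) ^ R * (D * (3 * (N * N)))       ≡⟨ regroup (16 ^ R) ((N * N) ^ R) D (N * N) ⟩
  16 ^ R * (3 * D) * (N * N) ^ suc R               ≤⟨ *-monoˡ-≤ ((N * N) ^ suc R) 16^R*3D≤C^R*C^R ⟩
  C ^ R * C ^ R * (N * N) ^ suc R                  ≡⟨ cong (C ^ R * C ^ R *_) (^-distribʳ-* N N (suc R)) ⟩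
  C ^ R * C ^ R * (N ^ suc R * N ^ suc R)          ≡⟨ *-interchange (C ^ R) (C ^ R) (N ^ suc R) (N ^ suc R) ⟩
  C ^ R * N ^ suc R * (C ^ R * N ^ suc R)          ∎)
  where
  open ≤-Reasoning
  R = suc r
  C = 48 * suc D
  -- t ^ 4 is spelled out, as solve-∀ fails on this equation when it is stated with _^_.
  square-4Nt² : ∀ N t → 4 * N * (t * t) * (4 * N * (t * t)) ≡ 16 * (N * N) * (t * (t * (t * (t * 1))))
  square-4Nt² = solve-∀
  regroup : ∀ a b d x → a * b * (d * (3 * x)) ≡ a * (3 * d) * (x * b)
  regroup = solve-∀
  16^R*3D≤C^R*C^R : 16 ^ R * (3 * D) ≤ C ^ R * C ^ R
  16^R*3D≤C^R*C^R = begin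
    16 ^ R * (3 * D)            ≤⟨ *-monoʳ-≤ (16 ^ R) (*-monoʳ-≤ 3 (n≤1+n D)) ⟩
    16 ^ R * (3 * suc D)        ≤⟨ *-monoʳ-≤ (16 ^ R) (m≤m*n (3 * suc D) ((3 * suc D) ^ r) {{m^n≢0 (3 * suc D) r}}) ⟩
    16 ^ R * (3 * suc D) ^ R    ≡⟨ ^-distribʳ-* 16 (3 * suc D) R ⟨
    (16 * (3 * suc D)) ^ R      ≡⟨ cong (_^ R) (*-assoc 16 3 (suc D)) ⟨
    C ^ R                       ≤⟨ m≤m*n (C ^ R) (C ^ R) {{m^n≢0 C R}} ⟩
    C ^ R * C ^ R               ∎

Sum₂^[1+q]≤C^[1+q]*N^[2+q] : ∀ κ q → ∃ λ C → ∀ N h → 1 ≤ h → h ≤ 2 * (N * N) →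
                              Sum₂ κ N h ^ suc q ≤ C ^ suc q * N ^ suc (suc q)
Sum₂^[1+q]≤C^[1+q]*N^[2+q] κ q with divisor-bound (4 * suc q)
... | D , τ-bound = 48 * suc D , λ N h 1≤h h≤2N² →
  S^r≤C^r*N^[1+r] (Sum₂ κ N h) N (maxτ (3 * (N * N))) D q
    (Sum₂≤4N*maxτ² κ N h 1≤h h≤2N²) (maxτ-bound {q + 3 * suc q} {D} τ-bound (3 * (N * N)))

lemma6p1 : (κ : Kind) →
    ((N h : ℕ) → 1 ≤ h → h ≤ 2 * (N * N) → Sum₁ κ N h ≤ Sum₂ κ N h)
    × ((p q : ℕ) → ∃ λ C → (N h : ℕ) → 1 ≤ h → h ≤ 2 * (N * N) →
         Sum₂ κ N h ^ suc q ≤ C ^ suc q * N ^ (suc q + suc p))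
lemma6p1 κ = (λ N h _ _ → Sum₁≤Sum₂ κ N h) , λ p q →
  let C , Sum₂-bound = Sum₂^[1+q]≤C^[1+q]*N^[2+q] κ q in
  C , λ N h 1≤h h≤2N² → ≤-trans (Sum₂-bound N h 1≤h h≤2N²)
        (*-monoʳ-≤ (C ^ suc q) (^-monoʳ-≤ N {{1≤h≤2N²⇒N≢0 1≤h h≤2N²}} (2+q≤[1+q]+[1+p] q p)))
  where
  2+q≤[1+q]+[1+p] : ∀ q p → suc (suc q) ≤ suc q + suc p
  2+q≤[1+q]+[1+p] q p = s≤s (≤-trans (s≤s (m≤m+n q p)) (≤-reflexive (sym (+-suc q p))))
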